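{- Let $K$ be a field with a non-trivial valuation $v$ and let $A(x)=\sum_{i=0}^n a_ix^i\in K[x]$ be an Eisenstein–Dumas polynomial at $v$ of degree $n$. Let $t\in K$ satisfy $nv(t)>v(a_0)-v(a_n)$. Then $$A(x)\begin{pmatrix}1&t\\0&1\end{pmatrix}=A(x+t)$$ is an Eisenstein–Dumas polynomial at $v$.
   Context: $v:K\to\Gamma\cup\{\infty\}$ is a non-trivial Krull valuation with values in a linearly ordered abelian group $\Gamma$ ($v(0)=\infty>g$ for all $g\in\Gamma$). A polynomial written $\sum_{i=0}^n b_ix^i$ is Eisenstein–Dumas at $v$ if (D0) $b_0b_n\neq0$; (D1) $v(b_0)-v(b_n)\notin k\Gamma=\{kg:g\in\Gamma\}$ for every integer $k>1$ dividing $n$; (D2) $nv(b_i)\ge (n-i)v(b_0)+iv(b_n)$ for $0\le i\le n$. $A(x+t)$ is regarded as a polynomial of degree $n$. -}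

module Defs where

open import Level using (Level; _⊔_; Lift) renaming (suc to lsuc)
open import Algebra.Bundles using (CommutativeRing; AbelianGroup)
open import Relation.Binary.Core using (Rel)
open import Relation.Binary.Structures using (IsTotalOrder)
open import Relation.Nullary using (¬_)
open import Relation.Binary.PropositionalEquality using (_≡_)
open import Data.Nat as ℕ using (ℕ; zero; suc; _∸_)
open import Data.Nat.Divisibility using (_∣_)
open import Data.Fin using (Fin; toℕ; fromℕ) renaming (zero to fzero)
open import Data.Vec using (Vec; []; _∷_; lookup; map; zipWith; _∷ʳ_)
open import Data.Maybe using (Maybe; just; nothing)
open import Data.Product using (Σ; ∃; _×_; _,_)
open import Data.Sum using (_⊎_)
open import Data.Empty using (⊥)
open import Data.Unit using (⊤)

record Field (c ℓ : Level) : Set (lsuc (c ⊔ ℓ)) where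
  field
    commutativeRing : CommutativeRing c ℓ
  open CommutativeRing commutativeRing public
  field
    0≉1     : ¬ (0# ≈ 1#)
    inverse : ∀ x → ¬ (x ≈ 0#) → Σ Carrier λ y → (x * y) ≈ 1#

record LinOrdAbGroup (c ℓ₁ ℓ₂ : Level) : Set (lsuc (c ⊔ ℓ₁ ⊔ ℓ₂)) where
  field
    abelianGroup : AbelianGroup c ℓ₁
  open AbelianGroup abelianGroup public
  field
    _≤_          : Rel Carrier ℓ₂
    isTotalOrder : IsTotalOrder _≈_ _≤_
    ≤-compat     : ∀ {x y} z → x ≤ y → (x ∙ z) ≤ (y ∙ z)

  _<_ : Rel Carrier (ℓ₁ ⊔ ℓ₂)
  x < y = (x ≤ y) × ¬ (x ≈ y)

  _·_ : ℕ → Carrier → Carrier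
  zero  · g = ε
  suc k · g = g ∙ (k · g)

  -- Γ ∪ {∞}, with  nothing = ∞
  Γ∞ : Set c
  Γ∞ = Maybe Carrier

  _≈∞_ : Γ∞ → Γ∞ → Set ℓ₁
  nothing ≈∞ nothing = Lift ℓ₁ ⊤
  just g  ≈∞ just h  = g ≈ h
  _       ≈∞ _       = Lift ℓ₁ ⊥

  _≤∞_ : Γ∞ → Γ∞ → Set ℓ₂
  _       ≤∞ nothing = Lift ℓ₂ ⊤
  just g  ≤∞ just h  = g ≤ h
  nothing ≤∞ just _  = Lift ℓ₂ ⊥

  _+∞_ : Γ∞ → Γ∞ → Γ∞
  just g  +∞ just h = just (g ∙ h)
  _       +∞ _      = nothing

record Valuation {c ℓ c' ℓ₁ ℓ₂} (K : Field c ℓ) (G : LinOrdAbGroup c' ℓ₁ ℓ₂)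
       : Set (c ⊔ ℓ ⊔ c' ⊔ ℓ₁ ⊔ ℓ₂) where
  private
    module K = Field K
    module G = LinOrdAbGroup G
  field
    v        : K.Carrier → G.Γ∞
    v-cong   : ∀ {x y} → x K.≈ y → v x G.≈∞ v y
    v-zero   : v K.0# ≡ nothing
    v-finite : ∀ x → ¬ (x K.≈ K.0#) → Σ G.Carrier λ g → v x ≡ just g
    v-mul    : ∀ x y → v (x K.* y) G.≈∞ (v x G.+∞ v y)
    v-add    : ∀ x y → (v x G.≤∞ v (x K.+ y)) ⊎ (v y G.≤∞ v (x K.+ y))
    nontrivial : Σ K.Carrier λ x → Σ G.Carrier λ g → (v x ≡ just g) × ¬ (g G.≈ G.ε)

-- Polynomials of degree ≤ n are coefficient vectors (b₀ , … , bₙ) of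
-- length n+1 (index i = coefficient of x^i).

module _ {c ℓ} (K : Field c ℓ) where
  open Field K

  mulXplus : Carrier → ∀ {k} → Vec Carrier k → Vec Carrier (suc k)
  mulXplus t q = zipWith _+_ (0# ∷ q) (map (t *_) q ∷ʳ 0#)

  addConst : Carrier → ∀ {k} → Vec Carrier (suc k) → Vec Carrier (suc k)
  addConst a (c ∷ cs) = (a + c) ∷ cs

  -- substitution  A(x) ↦ A(x + t)  (Horner scheme), kept with the same
  -- number of coefficients, i.e. regarded as a polynomial of degree n.
  substXplus : Carrier → ∀ {m} → Vec Carrier m → Vec Carrier m
  substXplus t []       = []
  substXplus t (a ∷ as) = addConst a (mulXplus t (substXplus t as))

module _ {c ℓ c' ℓ₁ ℓ₂} (K : Field c ℓ) (G : LinOrdAbGroup c' ℓ₁ ℓ₂)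
         (val : Valuation K G) where
  private
    module K = Field K
  open LinOrdAbGroup G
  open Valuation val

  record EisensteinDumas (n : ℕ) (b : Vec K.Carrier (suc n)) : Set (c ⊔ ℓ ⊔ c' ⊔ ℓ₁ ⊔ ℓ₂) where
    field
      D0 : ¬ ((lookup b fzero K.* lookup b (fromℕ n)) K.≈ K.0#)
      D1 : ∀ g₀ gₙ → v (lookup b fzero) ≡ just g₀ → v (lookup b (fromℕ n)) ≡ just gₙ →
           ∀ k → 1 ℕ.< k → k ∣ n → ¬ (Σ Carrier λ g → (g₀ - gₙ) ≈ (k · g))
      -- (D2) n v(bᵢ) ≥ (n-i) v(b₀) + i v(bₙ)  (trivially true when v(bᵢ) = ∞)
      D2 : ∀ g₀ gₙ → v (lookup b fzero) ≡ just g₀ → v (lookup b (fromℕ n)) ≡ just gₙ →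
           ∀ (i : Fin (suc n)) g → v (lookup b i) ≡ just g →
           (((n ∸ toℕ i) · g₀) ∙ (toℕ i · gₙ)) ≤ (n · g)

  -- the hypothesis  n v(t) > v(a₀) - v(aₙ)  (automatic when t = 0, v(t) = ∞)
  NVtBig : (n : ℕ) → Vec K.Carrier (suc n) → K.Carrier → Set (c' ⊔ ℓ₁ ⊔ ℓ₂)
  NVtBig n a t = ∀ g₀ gₙ → v (lookup a fzero) ≡ just g₀ → v (lookup a (fromℕ n)) ≡ just gₙ →
                 ∀ gₜ → v t ≡ just gₜ → (g₀ - gₙ) < (n · gₜ)

{-# OPTIONS --safe #-}
module Submission where

open import Defs
open import Level using (Level; _⊔_; lift)
open import Data.Nat using (ℕ; zero; suc; _∸_)
import Data.Nat as ℕ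
import Data.Nat.Properties as ℕ
open import Data.Fin using (toℕ; fromℕ) renaming (zero to fzero; suc to fsuc)
open import Data.Fin.Properties using (toℕ≤pred[n])
open import Data.Vec using (Vec; []; _∷_; lookup; map; zipWith; _∷ʳ_)
open import Data.Maybe using (just; nothing)
open import Data.Maybe.Properties using (just-injective)
open import Data.Product using (∃; ∃₂; _×_; _,_; proj₁; proj₂)
open import Data.Sum using (_⊎_; inj₁; inj₂)
open import Function using (_∘_)
open import Relation.Nullary using (¬_; contradiction)
open import Relation.Binary.PropositionalEquality as P using (_≡_)
open import Relation.Binary.Bundles using (TotalOrder)
import Relation.Binary.Properties.TotalOrder as TotalOrderProperties
import Relation.Binary.Reasoning.Setoid as SetoidReasoning
import Algebra.Properties.AbelianGroup as AbelianGroupProperties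
import Algebra.Properties.CommutativeSemigroup as CommutativeSemigroupProperties
import Algebra.Properties.Ring as RingProperties

-- Write g₀ = v(a₀) and gₙ = v(aₙ).  Condition (D2) says that every coefficient lies on or
-- above the segment from (0, g₀) to (n, gₙ); scaled by n, the bound at position k is
-- (n − k) g₀ + k gₙ ∈ Γ.  A(x + t) is computed by the Horner scheme b ↦ a + (x + t) b.  Sums
-- stay above the line by the ultrametric inequality, and multiplying by t costs at most one
-- step of the slope because n v(t) ≥ g₀ − gₙ; so A(x + t) satisfies (D2) for the same g₀, gₙ.
-- Its leading coefficient is aₙ, and its constant term is a₀ + t c with c above the line at
-- position 1, where the strict hypothesis gives n v(t c) > n g₀, hence v(a₀ + t c) = g₀.  With
-- v(b₀) and v(bₙ) unchanged, (D0) and (D1) are inherited from A.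

module LinOrdAbGroupProperties {c ℓ₁ ℓ₂} (G : LinOrdAbGroup c ℓ₁ ℓ₂) where
  open LinOrdAbGroup G
  open AbelianGroupProperties abelianGroup public
  open CommutativeSemigroupProperties commutativeSemigroup public
    using (interchange; x∙yz≈y∙xz; xy∙z≈xz∙y)

  totalOrder : TotalOrder c ℓ₁ ℓ₂
  totalOrder = record { isTotalOrder = isTotalOrder }

  open TotalOrder totalOrder public
    using (antisym; total; ≤-respˡ-≈; ≤-respʳ-≈)
    renaming (refl to ≤-refl; trans to ≤-trans)
  open TotalOrderProperties totalOrder public
    using (≰⇒>; <-irrefl; <-respʳ-≈; <-respˡ-≈; <⇒≱)

  ∙-monoˡ-≤ : ∀ z {x y} → x ≤ y → (x ∙ z) ≤ (y ∙ z)
  ∙-monoˡ-≤ z = ≤-compat z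

  ∙-monoʳ-≤ : ∀ z {x y} → x ≤ y → (z ∙ x) ≤ (z ∙ y)
  ∙-monoʳ-≤ z x≤y = ≤-respʳ-≈ (comm _ z) (≤-respˡ-≈ (comm _ z) (∙-monoˡ-≤ z x≤y))

  ∙-mono-≤ : ∀ {x y u w} → x ≤ y → u ≤ w → (x ∙ u) ≤ (y ∙ w)
  ∙-mono-≤ x≤y u≤w = ≤-trans (∙-monoˡ-≤ _ x≤y) (∙-monoʳ-≤ _ u≤w)

  ∙-mono-<-≤ : ∀ {x y u w} → x < y → u ≤ w → (x ∙ u) < (y ∙ w)
  ∙-mono-<-≤ {x} {y} {u} {w} (x≤y , x≉y) u≤w = ∙-mono-≤ x≤y u≤w , x∙u≉y∙w
    where
    x∙u≉y∙w : ¬ (x ∙ u ≈ y ∙ w)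
    x∙u≉y∙w e = x≉y (∙-cancelʳ u x y (antisym (∙-monoˡ-≤ u x≤y) y∙u≤x∙u))
      where
      y∙u≤x∙u : (y ∙ u) ≤ (x ∙ u)
      y∙u≤x∙u = ≤-respʳ-≈ (sym e) (∙-monoʳ-≤ y u≤w)

  ·-cong : ∀ k {x y} → x ≈ y → k · x ≈ k · y
  ·-cong zero    x≈y = refl
  ·-cong (suc k) x≈y = ∙-cong x≈y (·-cong k x≈y)

  ·-mono-≤ : ∀ k {x y} → x ≤ y → (k · x) ≤ (k · y)
  ·-mono-≤ zero    x≤y = ≤-refl
  ·-mono-≤ (suc k) x≤y = ∙-mono-≤ x≤y (·-mono-≤ k x≤y)

  ·-distrib-∙ : ∀ k x y → k · (x ∙ y) ≈ k · x ∙ k · y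
  ·-distrib-∙ zero    x y = sym (identityʳ ε)
  ·-distrib-∙ (suc k) x y = trans (∙-cong refl (·-distrib-∙ k x y)) (interchange x y (k · x) (k · y))

  ·-homo-+ : ∀ a b x → (a ℕ.+ b) · x ≈ a · x ∙ b · x
  ·-homo-+ zero    b x = sym (identityˡ _)
  ·-homo-+ (suc a) b x = trans (∙-cong refl (·-homo-+ a b x)) (sym (assoc x _ _))

  ·-cancel-< : ∀ k {g h} → (k · g) < (k · h) → g < h
  ·-cancel-< k kg<kh = ≰⇒> (<⇒≱ kg<kh ∘ ·-mono-≤ k)

  x∙x≈ε⇒x≈ε : ∀ x → x ∙ x ≈ ε → x ≈ ε
  x∙x≈ε⇒x≈ε x e with total x ε
  ... | inj₁ x≤ε = antisym x≤ε (≤-respˡ-≈ e (≤-respʳ-≈ (identityˡ x) (∙-monoˡ-≤ x x≤ε)))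
  ... | inj₂ ε≤x = antisym (≤-respʳ-≈ e (≤-respˡ-≈ (identityˡ x) (∙-monoˡ-≤ x ε≤x))) ε≤x

  ≈∞-just⁻¹ : ∀ {a g} → a ≈∞ just g → ∃ λ h → a ≡ just h × h ≈ g
  ≈∞-just⁻¹ {just h}  h≈g      = h , P.refl , h≈g
  ≈∞-just⁻¹ {nothing} (lift ())

  ≤∞-just⁻¹ : ∀ {a g} → a ≤∞ just g → ∃ λ h → a ≡ just h × h ≤ g
  ≤∞-just⁻¹ {just h}  h≤g      = h , P.refl , h≤g
  ≤∞-just⁻¹ {nothing} (lift ())

  +∞-just⁻¹ : ∀ a b {g} → just g ≈∞ (a +∞ b) → ∃₂ λ x y → a ≡ just x × b ≡ just y × g ≈ x ∙ y
  +∞-just⁻¹ (just x) (just y) e        = x , y , P.refl , P.refl , e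
  +∞-just⁻¹ (just x) nothing  (lift ())
  +∞-just⁻¹ nothing  _        (lift ())

module Line {c ℓ₁ ℓ₂} (G : LinOrdAbGroup c ℓ₁ ℓ₂) (n : ℕ) (g₀ gₙ : LinOrdAbGroup.Carrier G) where
  open LinOrdAbGroup G
  open LinOrdAbGroupProperties G
  open SetoidReasoning setoid

  -- n times the height at k of the line through (0, g₀) and (n, gₙ), defined by recursion so
  -- that line-step holds for every k and not only for k ≤ n.
  line : ℕ → Carrier
  line zero    = n · g₀
  line (suc k) = line k ∙ (gₙ - g₀)

  line-step : ∀ k → (g₀ - gₙ) ∙ line (suc k) ≈ line k
  line-step k = begin
    (g₀ - gₙ) ∙ (line k ∙ (gₙ - g₀))      ≈⟨ x∙yz≈y∙xz _ _ _ ⟩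
    line k ∙ ((g₀ - gₙ) ∙ (gₙ - g₀))      ≈⟨ ∙-cong refl (∙-cong (⁻¹-anti-homo‿- gₙ g₀) refl) ⟨
    line k ∙ ((gₙ - g₀) ⁻¹ ∙ (gₙ - g₀))   ≈⟨ ∙-cong refl (inverseˡ _) ⟩
    line k ∙ ε                            ≈⟨ identityʳ _ ⟩
    line k                                ∎

  line-∙-· : ∀ k → line k ∙ k · g₀ ≈ n · g₀ ∙ k · gₙ
  line-∙-· zero    = refl
  line-∙-· (suc k) = begin
    (line k ∙ (gₙ - g₀)) ∙ (g₀ ∙ k · g₀)  ≈⟨ ∙-cong refl (comm _ _) ⟩
    (line k ∙ (gₙ - g₀)) ∙ (k · g₀ ∙ g₀)  ≈⟨ interchange _ _ _ _ ⟩
    (line k ∙ k · g₀) ∙ ((gₙ - g₀) ∙ g₀)  ≈⟨ ∙-cong (line-∙-· k) (//-rightDividesˡ g₀ gₙ) ⟩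
    (n · g₀ ∙ k · gₙ) ∙ gₙ               ≈⟨ assoc _ _ _ ⟩
    n · g₀ ∙ (k · gₙ ∙ gₙ)               ≈⟨ ∙-cong refl (comm _ _) ⟩
    n · g₀ ∙ (gₙ ∙ k · gₙ)               ∎

  line-closed : ∀ {k} → k ℕ.≤ n → line k ≈ (n ∸ k) · g₀ ∙ k · gₙ
  line-closed {k} k≤n = ∙-cancelʳ (k · g₀) _ _ (begin
    line k ∙ k · g₀                    ≈⟨ line-∙-· k ⟩
    n · g₀ ∙ k · gₙ                    ≡⟨ P.cong (λ m → m · g₀ ∙ k · gₙ) (ℕ.m∸n+n≡m k≤n) ⟨
    ((n ∸ k) ℕ.+ k) · g₀ ∙ k · gₙ      ≈⟨ ∙-cong (·-homo-+ (n ∸ k) k g₀) refl ⟩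
    ((n ∸ k) · g₀ ∙ k · g₀) ∙ k · gₙ   ≈⟨ xy∙z≈xz∙y _ _ _ ⟩
    ((n ∸ k) · g₀ ∙ k · gₙ) ∙ k · g₀   ∎)

module FieldProperties {c ℓ} (K : Field c ℓ) where
  open Field K

  x*y≉0⇒x≉0 : ∀ {x y} → ¬ (x * y ≈ 0#) → ¬ (x ≈ 0#)
  x*y≉0⇒x≉0 {x} {y} xy≉0 x≈0 = xy≉0 (trans (*-cong x≈0 refl) (zeroˡ y))

  x*y≉0⇒y≉0 : ∀ {x y} → ¬ (x * y ≈ 0#) → ¬ (y ≈ 0#)
  x*y≉0⇒y≉0 {x} {y} xy≉0 y≈0 = xy≉0 (trans (*-cong refl y≈0) (zeroʳ x))

module SubstXplusProperties {c ℓ} (K : Field c ℓ) where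
  open Field K
  open SetoidReasoning setoid

  -- p + (x + t) q.  mulXplus K t q unfolds to plusMulXplus t 0# q; generalising the constant
  -- 0# to p makes the recursion on q structural.
  plusMulXplus : Carrier → Carrier → ∀ {m} → Vec Carrier m → Vec Carrier (suc m)
  plusMulXplus t p q = zipWith _+_ (p ∷ q) (map (t *_) q ∷ʳ 0#)

  lookup-addConst-zero : ∀ a {m} (q : Vec Carrier (suc m)) →
                         lookup (addConst K a q) fzero ≡ a + lookup q fzero
  lookup-addConst-zero a (_ ∷ _) = P.refl

  lookup-addConst-suc : ∀ a {m} (q : Vec Carrier (suc m)) i →
                        lookup (addConst K a q) (fsuc i) ≡ lookup q (fsuc i)
  lookup-addConst-suc a (_ ∷ _) i = P.refl

  last-plusMulXplus : ∀ t p {m} (q : Vec Carrier m) →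
                      lookup (plusMulXplus t p q) (fromℕ m) ≈ lookup (p ∷ q) (fromℕ m)
  last-plusMulXplus t p []       = +-identityʳ p
  last-plusMulXplus t p (x ∷ xs) = last-plusMulXplus t x xs

  last-substXplus : ∀ t {m} (q : Vec Carrier (suc m)) →
                    lookup (substXplus K t q) (fromℕ m) ≈ lookup q (fromℕ m)
  last-substXplus t (a ∷ [])         = trans (+-cong refl (+-identityʳ 0#)) (+-identityʳ a)
  last-substXplus t {suc m} (a ∷ as) = begin
    lookup (addConst K a (mulXplus K t (substXplus K t as))) (fsuc (fromℕ m))
      ≡⟨ lookup-addConst-suc a (mulXplus K t (substXplus K t as)) (fromℕ m) ⟩
    lookup (mulXplus K t (substXplus K t as)) (fsuc (fromℕ m))
      ≈⟨ last-plusMulXplus t 0# (substXplus K t as) ⟩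
    lookup (substXplus K t as) (fromℕ m)
      ≈⟨ last-substXplus t as ⟩
    lookup as (fromℕ m)
      ∎

module ValuationProperties {c ℓ c' ℓ₁ ℓ₂} {K : Field c ℓ} {G : LinOrdAbGroup c' ℓ₁ ℓ₂}
                           (val : Valuation K G) where
  private
    module K = Field K
    module KR = RingProperties K.ring
    module K+ = AbelianGroupProperties K.+-abelianGroup
  open LinOrdAbGroup G
  open LinOrdAbGroupProperties G
  open Valuation val

  v-just⇒≉0 : ∀ {x g} → v x ≡ just g → ¬ (x K.≈ K.0#)
  v-just⇒≉0 {x} vx x≈0 with P.subst₂ _≈∞_ vx v-zero (v-cong x≈0)
  ... | lift ()

  v-cong-just : ∀ {x y g} → x K.≈ y → v y ≡ just g → ∃ λ h → v x ≡ just h × h ≈ g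
  v-cong-just {x} x≈y vy = ≈∞-just⁻¹ (P.subst (v x ≈∞_) vy (v-cong x≈y))

  v-just-unique : ∀ {x g h} → v x ≡ just g → v x ≡ just h → g ≈ h
  v-just-unique vx vx' = reflexive (just-injective (P.trans (P.sym vx) vx'))

  v-*-just : ∀ x y {g} → v (x K.* y) ≡ just g →
             ∃₂ λ gx gy → v x ≡ just gx × v y ≡ just gy × g ≈ gx ∙ gy
  v-*-just x y vxy = +∞-just⁻¹ (v x) (v y) (P.subst (_≈∞ (v x +∞ v y)) vxy (v-mul x y))

  v-*-≉0 : ∀ {x y gx gy} → v x ≡ just gx → v y ≡ just gy → ¬ (x K.* y K.≈ K.0#)
  v-*-≉0 {x} {y} vx vy =
    v-just⇒≉0 (proj₁ (proj₂ (≈∞-just⁻¹ (P.subst₂ (λ a b → v (x K.* y) ≈∞ (a +∞ b)) vx vy (v-mul x y)))))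

  v-+-just : ∀ x y {g} → v (x K.+ y) ≡ just g →
             (∃ λ h → v x ≡ just h × h ≤ g) ⊎ (∃ λ h → v y ≡ just h × h ≤ g)
  v-+-just x y vxy with v-add x y
  ... | inj₁ vx≤ = inj₁ (≤∞-just⁻¹ (P.subst (v x ≤∞_) vxy vx≤))
  ... | inj₂ vy≤ = inj₂ (≤∞-just⁻¹ (P.subst (v y ≤∞_) vxy vy≤))

  v-*-≈ : ∀ {x y z gx gy gz} → x K.* y K.≈ z →
          v x ≡ just gx → v y ≡ just gy → v z ≡ just gz → gx ∙ gy ≈ gz
  v-*-≈ {x} {y} {gx = gx} {gy} {gz} xy≈z vx vy vz with v-cong-just xy≈z vz
  ... | h , vxy , h≈gz with v-*-just x y vxy
  ... | gx' , gy' , vx' , vy' , h≈gx'gy' = begin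
    gx ∙ gy   ≈⟨ ∙-cong (v-just-unique vx vx') (v-just-unique vy vy') ⟩
    gx' ∙ gy' ≈⟨ h≈gx'gy' ⟨
    h         ≈⟨ h≈gz ⟩
    gz        ∎
    where open SetoidReasoning setoid

  v-1#≈ε : ∀ {g} → v K.1# ≡ just g → g ≈ ε
  v-1#≈ε {g} v1 = identityˡ-unique g g (v-*-≈ (K.*-identityˡ K.1#) v1 v1 v1)

  v-[-1]≈ε : ∀ {g} → v (K.- K.1#) ≡ just g → g ≈ ε
  v-[-1]≈ε {g} v-1 =
    let (g₁ , v1) = v-finite K.1# (K.0≉1 ∘ K.sym)
        -1*-1≈1   = K.trans (KR.-1*x≈-x (K.- K.1#)) (KR.-‿involutive K.1#)
    in x∙x≈ε⇒x≈ε g (trans (v-*-≈ -1*-1≈1 v-1 v-1 v1) (v-1#≈ε v1))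

  v-neg-just : ∀ {x g} → v (K.- x) ≡ just g → ∃ λ h → v x ≡ just h × h ≈ g
  v-neg-just {x} {g} v-x with v-cong-just (KR.-1*x≈-x x) v-x
  ... | h , v-1x , h≈g with v-*-just _ _ v-1x
  ... | e , gx , v-1≡e , vx≡gx , h≈egx = gx , vx≡gx , (begin
    gx     ≈⟨ identityˡ gx ⟨
    ε ∙ gx ≈⟨ ∙-cong (v-[-1]≈ε v-1≡e) refl ⟨
    e ∙ gx ≈⟨ h≈egx ⟨
    h      ≈⟨ h≈g ⟩
    g      ∎)
    where open SetoidReasoning setoid

  infix 4 _<v_ _≤_·v_ _<_·v_

  _<v_ : Carrier → K.Carrier → Set (c' ⊔ ℓ₁ ⊔ ℓ₂)
  g <v x = ∀ h → v x ≡ just h → g < h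

  <v-0# : ∀ {g} → g <v K.0#
  <v-0# h v0 = contradiction (P.trans (P.sym v-zero) v0) λ ()

  <v-respʳ : ∀ {g x y} → x K.≈ y → g <v x → g <v y
  <v-respʳ x≈y g<vx h vy with v-cong-just x≈y vy
  ... | h' , vx , h'≈h = <-respʳ-≈ h'≈h (g<vx h' vx)

  <v-neg : ∀ {g x} → g <v x → g <v (K.- x)
  <v-neg g<vx h v-x with v-neg-just v-x
  ... | h' , vx , h'≈h = <-respʳ-≈ h'≈h (g<vx h' vx)

  v-+-dominant : ∀ {a y g} → v a ≡ just g → g <v y → ∃ λ h → v (a K.+ y) ≡ just h × h ≈ g
  v-+-dominant {a} {y} {g} va g<vy with v-finite (a K.+ y) a+y≉0
    where
    a+y≉0 : ¬ (a K.+ y K.≈ K.0#)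
    a+y≉0 a+y≈0 with v-cong-just (K.sym (K+.inverseˡ-unique a y a+y≈0)) va
    ... | h , v-y , h≈g = <-irrefl (sym h≈g) (<v-neg g<vy h v-y)
  ... | h , vay = h , vay , antisym h≤g g≤h
    where
    g≤h : g ≤ h
    g≤h with v-+-just a y vay
    ... | inj₁ (g' , va' , g'≤h) = ≤-respˡ-≈ (v-just-unique va' va) g'≤h
    ... | inj₂ (k , vy , k≤h)    = ≤-trans (proj₁ (g<vy k vy)) k≤h

    h≤g : h ≤ g
    h≤g with v-cong-just (K+.//-rightDividesʳ y a) va
    ... | g' , va' , g'≈g with v-+-just (a K.+ y) (K.- y) va'
    ... | inj₁ (h' , vay' , h'≤g') = ≤-respˡ-≈ (v-just-unique vay' vay) (≤-respʳ-≈ g'≈g h'≤g')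
    ... | inj₂ (k , v-y , k≤g')    = contradiction (≤-respʳ-≈ g'≈g k≤g') (<⇒≱ (<v-neg g<vy k v-y))

  -- w ≤ n ·v x stands for w ≤ n v(x), vacuous when v(x) = ∞.  These are records rather than
  -- functions so that w and n can be inferred from the type.
  record _≤_·v_ (w : Carrier) (n : ℕ) (x : K.Carrier) : Set (c' ⊔ ℓ₂) where
    constructor mk≤·v
    field ≤·v-at : ∀ h → v x ≡ just h → w ≤ (n · h)
  open _≤_·v_ public

  record _<_·v_ (w : Carrier) (n : ℕ) (x : K.Carrier) : Set (c' ⊔ ℓ₁ ⊔ ℓ₂) where
    constructor mk<·v
    field <·v-at : ∀ h → v x ≡ just h → w < (n · h)
  open _<_·v_ public

  ≤·v-0# : ∀ {w n} → w ≤ n ·v K.0#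
  ≤·v-0# = mk≤·v λ h v0 → contradiction (P.trans (P.sym v-zero) v0) λ ()

  ≤·v-respˡ : ∀ {w w' n x} → w ≈ w' → w ≤ n ·v x → w' ≤ n ·v x
  ≤·v-respˡ w≈w' (mk≤·v w≤) = mk≤·v λ h vx → ≤-respˡ-≈ w≈w' (w≤ h vx)

  <·v-respˡ : ∀ {w w' n x} → w ≈ w' → w < n ·v x → w' < n ·v x
  <·v-respˡ w≈w' (mk<·v w<) = mk<·v λ h vx → <-respˡ-≈ w≈w' (w< h vx)

  <·v⇒≤·v : ∀ {w n x} → w < n ·v x → w ≤ n ·v x
  <·v⇒≤·v (mk<·v w<) = mk≤·v λ h vx → proj₁ (w< h vx)

  <·v⇒<v : ∀ {g n x} → (n · g) < n ·v x → g <v x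
  <·v⇒<v {n = n} (mk<·v ng<) h vx = ·-cancel-< n (ng< h vx)

  ≤·v-+ : ∀ {w n x y} → w ≤ n ·v x → w ≤ n ·v y → w ≤ n ·v (x K.+ y)
  ≤·v-+ {w} {n} {x} {y} (mk≤·v w≤x) (mk≤·v w≤y) = mk≤·v w≤x+y
    where
    w≤x+y : ∀ h → v (x K.+ y) ≡ just h → w ≤ (n · h)
    w≤x+y h vxy with v-+-just x y vxy
    ... | inj₁ (h' , vx , h'≤h) = ≤-trans (w≤x h' vx) (·-mono-≤ n h'≤h)
    ... | inj₂ (h' , vy , h'≤h) = ≤-trans (w≤y h' vy) (·-mono-≤ n h'≤h)

  ≤·v-* : ∀ {u w n s x} → u ≤ n ·v s → w ≤ n ·v x → (u ∙ w) ≤ n ·v (s K.* x)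
  ≤·v-* {u} {w} {n} {s} {x} (mk≤·v u≤) (mk≤·v w≤) = mk≤·v uw≤
    where
    uw≤ : ∀ h → v (s K.* x) ≡ just h → (u ∙ w) ≤ (n · h)
    uw≤ h vsx with v-*-just s x vsx
    ... | hs , hx , vs , vx , h≈hshx =
      ≤-respʳ-≈ (trans (sym (·-distrib-∙ n hs hx)) (·-cong n (sym h≈hshx))) (∙-mono-≤ (u≤ hs vs) (w≤ hx vx))

  <·v-* : ∀ {u w n s x} → u < n ·v s → w ≤ n ·v x → (u ∙ w) < n ·v (s K.* x)
  <·v-* {u} {w} {n} {s} {x} (mk<·v u<) (mk≤·v w≤) = mk<·v uw<
    where
    uw< : ∀ h → v (s K.* x) ≡ just h → (u ∙ w) < (n · h)
    uw< h vsx with v-*-just s x vsx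
    ... | hs , hx , vs , vx , h≈hshx =
      <-respʳ-≈ (trans (sym (·-distrib-∙ n hs hx)) (·-cong n (sym h≈hshx))) (∙-mono-<-≤ (u< hs vs) (w≤ hx vx))

module NewtonLine {c ℓ c' ℓ₁ ℓ₂} {K : Field c ℓ} {G : LinOrdAbGroup c' ℓ₁ ℓ₂}
                  (val : Valuation K G) (n : ℕ) (g₀ gₙ : LinOrdAbGroup.Carrier G) where
  private
    module K = Field K
  open LinOrdAbGroup G
  open Valuation val
  open ValuationProperties val
  open Line G n g₀ gₙ
  open SubstXplusProperties K

  data AboveLine : ℕ → ∀ {m} → Vec K.Carrier m → Set (c ⊔ c' ⊔ ℓ₂) where
    []  : ∀ {k} → AboveLine k []
    _∷_ : ∀ {k x m} {xs : Vec K.Carrier m} →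
          line k ≤ n ·v x → AboveLine (suc k) xs → AboveLine k (x ∷ xs)

  AboveLine-lookup : ∀ {k m} {q : Vec K.Carrier m} → AboveLine k q →
                     ∀ i → line (k ℕ.+ toℕ i) ≤ n ·v lookup q i
  AboveLine-lookup {k} {q = x ∷ _}  (x≥ ∷ _)   fzero    =
    P.subst (λ j → line j ≤ n ·v x) (P.sym (ℕ.+-identityʳ k)) x≥
  AboveLine-lookup {k} {q = _ ∷ xs} (_ ∷ xs≥) (fsuc i) =
    P.subst (λ j → line j ≤ n ·v lookup xs i) (P.sym (ℕ.+-suc k (toℕ i))) (AboveLine-lookup xs≥ i)

  AboveLine-tabulate : ∀ {k m} {q : Vec K.Carrier m} →
                       (∀ i → line (k ℕ.+ toℕ i) ≤ n ·v lookup q i) → AboveLine k q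
  AboveLine-tabulate     {q = []}     q≥ = []
  AboveLine-tabulate {k} {q = x ∷ xs} q≥ =
    P.subst (λ j → line j ≤ n ·v x) (ℕ.+-identityʳ k) (q≥ fzero) ∷
    AboveLine-tabulate (λ i → P.subst (λ j → line j ≤ n ·v lookup xs i) (ℕ.+-suc k (toℕ i)) (q≥ (fsuc i)))

  module _ {t : K.Carrier} (slope : (g₀ - gₙ) ≤ n ·v t) where

    line-*ˡ : ∀ {k x} → line (suc k) ≤ n ·v x → line k ≤ n ·v (t K.* x)
    line-*ˡ {k} x≥ = ≤·v-respˡ (line-step k) (≤·v-* slope x≥)

    AboveLine-plusMulXplus : ∀ {k p m} {q : Vec K.Carrier m} →
                             line k ≤ n ·v p → AboveLine (suc k) q → AboveLine k (plusMulXplus t p q)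
    AboveLine-plusMulXplus     p≥ []         = ≤·v-+ p≥ ≤·v-0# ∷ []
    AboveLine-plusMulXplus {k} p≥ (x≥ ∷ xs≥) = ≤·v-+ p≥ (line-*ˡ {k} x≥) ∷ AboveLine-plusMulXplus x≥ xs≥

    AboveLine-addConst : ∀ {k a m} {q : Vec K.Carrier (suc m)} →
                         line k ≤ n ·v a → AboveLine k q → AboveLine k (addConst K a q)
    AboveLine-addConst a≥ (x≥ ∷ xs≥) = ≤·v-+ a≥ x≥ ∷ xs≥

    AboveLine-substXplus : ∀ {k m} {q : Vec K.Carrier m} → AboveLine k q → AboveLine k (substXplus K t q)
    AboveLine-substXplus []         = []
    AboveLine-substXplus (a≥ ∷ as≥) =
      AboveLine-addConst a≥ (AboveLine-plusMulXplus ≤·v-0# (AboveLine-substXplus as≥))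

  module _ {t : K.Carrier} (slope : (g₀ - gₙ) < n ·v t) where

    <v-head-mulXplus : ∀ {m} {q : Vec K.Carrier m} → AboveLine 1 q → g₀ <v lookup (mulXplus K t q) fzero
    <v-head-mulXplus []       = <v-respʳ (K.sym (K.+-identityʳ K.0#)) <v-0#
    <v-head-mulXplus (c≥ ∷ _) =
      <v-respʳ (K.sym (K.+-identityˡ _)) (<·v⇒<v (<·v-respˡ (line-step 0) (<·v-* slope c≥)))

    v-head-substXplus : ∀ {a m} {as : Vec K.Carrier m} → v a ≡ just g₀ → AboveLine 0 (a ∷ as) →
                        ∃ λ g → v (lookup (substXplus K t (a ∷ as)) fzero) ≡ just g × g ≈ g₀
    v-head-substXplus {a} {as = as} va (_ ∷ as≥) =
      P.subst (λ b → ∃ λ g → v b ≡ just g × g ≈ g₀)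
              (P.sym (lookup-addConst-zero a (mulXplus K t (substXplus K t as))))
              (v-+-dominant va (<v-head-mulXplus (AboveLine-substXplus (<·v⇒≤·v slope) as≥)))

module EisensteinDumasProperties {c ℓ c' ℓ₁ ℓ₂} {K : Field c ℓ} {G : LinOrdAbGroup c' ℓ₁ ℓ₂}
                                 (val : Valuation K G) (n : ℕ) where
  open LinOrdAbGroup G
  open LinOrdAbGroupProperties G
  open Valuation val
  open ValuationProperties val
  open FieldProperties K
  open NewtonLine val n
  open Line G n
  open EisensteinDumas

  EisensteinDumas-values : ∀ {b} → EisensteinDumas K G val n b →
                           ∃₂ λ g₀ gₙ → v (lookup b fzero) ≡ just g₀ × v (lookup b (fromℕ n)) ≡ just gₙ
  EisensteinDumas-values ed =
    let (g₀ , vb₀) = v-finite _ (x*y≉0⇒x≉0 (D0 ed))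
        (gₙ , vbₙ) = v-finite _ (x*y≉0⇒y≉0 (D0 ed))
    in g₀ , gₙ , vb₀ , vbₙ

  EisensteinDumas⇒AboveLine : ∀ {b g₀ gₙ} → EisensteinDumas K G val n b →
                              v (lookup b fzero) ≡ just g₀ → v (lookup b (fromℕ n)) ≡ just gₙ →
                              AboveLine g₀ gₙ 0 b
  EisensteinDumas⇒AboveLine {g₀ = g₀} {gₙ} ed vb₀ vbₙ = AboveLine-tabulate g₀ gₙ λ i →
    mk≤·v λ h vbᵢ → ≤-respˡ-≈ (sym (line-closed g₀ gₙ (toℕ≤pred[n] i))) (D2 ed g₀ gₙ vb₀ vbₙ i h vbᵢ)

  EisensteinDumas-transfer : ∀ {a b g₀ gₙ} → EisensteinDumas K G val n a →
                             v (lookup a fzero) ≡ just g₀ → v (lookup a (fromℕ n)) ≡ just gₙ →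
                             (∃ λ g → v (lookup b fzero) ≡ just g × g ≈ g₀) →
                             (∃ λ g → v (lookup b (fromℕ n)) ≡ just g × g ≈ gₙ) →
                             AboveLine g₀ gₙ 0 b → EisensteinDumas K G val n b
  EisensteinDumas-transfer {b = b} {g₀} {gₙ} ed va₀ vaₙ (g₀' , vb₀ , g₀'≈g₀) (gₙ' , vbₙ , gₙ'≈gₙ) b≥ = record
    { D0 = v-*-≉0 vb₀ vbₙ
    ; D1 = λ h₀ hₙ vb₀' vbₙ' k 1<k k∣n (g , h₀-hₙ≈k·g) →
             D1 ed g₀ gₙ va₀ vaₙ k 1<k k∣n
               (g , trans (∙-cong (sym (h₀≈g₀ vb₀')) (⁻¹-cong (sym (hₙ≈gₙ vbₙ')))) h₀-hₙ≈k·g)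
    ; D2 = λ h₀ hₙ vb₀' vbₙ' i h vbᵢ →
             ≤-respˡ-≈ (trans (line-closed g₀ gₙ (toℕ≤pred[n] i))
                              (∙-cong (·-cong (n ∸ toℕ i) (sym (h₀≈g₀ vb₀'))) (·-cong (toℕ i) (sym (hₙ≈gₙ vbₙ')))))
                       (≤·v-at (AboveLine-lookup g₀ gₙ b≥ i) h vbᵢ)
    }
    where
    h₀≈g₀ : ∀ {h₀} → v (lookup b fzero) ≡ just h₀ → h₀ ≈ g₀
    h₀≈g₀ vb₀' = trans (v-just-unique vb₀' vb₀) g₀'≈g₀

    hₙ≈gₙ : ∀ {hₙ} → v (lookup b (fromℕ n)) ≡ just hₙ → hₙ ≈ gₙ
    hₙ≈gₙ vbₙ' = trans (v-just-unique vbₙ' vbₙ) gₙ'≈gₙ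

open EisensteinDumasProperties
open ValuationProperties
open NewtonLine
open SubstXplusProperties

lemma2p3 : ∀ {c ℓ c' ℓ₁ ℓ₂ : Level} (K : Field c ℓ) (G : LinOrdAbGroup c' ℓ₁ ℓ₂)
             (val : Valuation K G) (n : ℕ) (A : Vec (Field.Carrier K) (suc n))
             (t : Field.Carrier K) →
             EisensteinDumas K G val n A →
             NVtBig K G val n A t →
             EisensteinDumas K G val n (substXplus K t A)
lemma2p3 K G val n A@(_ ∷ _) t ed nvt =
  let (g₀ , gₙ , va₀ , vaₙ) = EisensteinDumas-values val n ed
      A≥    = EisensteinDumas⇒AboveLine val n ed va₀ vaₙ
      slope = mk<·v (nvt g₀ gₙ va₀ vaₙ)
  in EisensteinDumas-transfer val n ed va₀ vaₙ
       (v-head-substXplus val n g₀ gₙ slope va₀ A≥)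
       (v-cong-just val (last-substXplus K t A) vaₙ)
       (AboveLine-substXplus val n g₀ gₙ (<·v⇒≤·v val slope) A≥)
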